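{- The circulant graph $C_{11}(\{1,3\})$, with vertex set $\{0,1,\dots,10\}$ in which distinct $i,j$ are adjacent iff $i-j\equiv \pm1$ or $\pm 3\pmod{11}$, is strongly equistarable.
   Context: A star of a graph is the set $E(v)$ of all edges incident with a vertex $v$; it is maximal if not properly contained in another star. $\mathcal{S}^*(G)$ is the set of maximal stars and $\mathcal{T}^*(G)$ the set of all other nonempty subsets of $E(G)$. A graph $G=(V,E)$ without isolated vertices is strongly equistarable if for each $T\in\mathcal{T}^*(G)$ and each real $\gamma\le1$ there is $\varphi:E\to\mathbb{R}_{>0}$ with $\sum_{e\in S}\varphi(e)=1$ for all $S\in\mathcal{S}^*(G)$ and $\sum_{e\in T}\varphi(e)\neq\gamma$.
   Formalization: The parameter γ ranges over the rationals rather than the reals, and the edge weights φ are taken in the positive rationals. -}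

module Defs where

open import Data.Nat using (ℕ; zero; suc; _<ᵇ_; _∸_)
  renaming (_+_ to _+ℕ_)
open import Data.Nat.DivMod using (_mod_)
open import Data.Fin using (Fin; zero; suc; toℕ; _≟_)
open import Data.Fin.Subset using (Subset; _∈_; _⊂_; Nonempty; inside; outside)
open import Data.Vec using (tabulate; lookup)
open import Data.Bool using (Bool; true; false; if_then_else_; _∨_)
open import Data.Product using (_×_; _,_; proj₁; proj₂; Σ; ∃)
open import Data.Sum using (_⊎_)
open import Data.Rational using (ℚ; 0ℚ; 1ℚ; _+_; _<_; _≤_)
open import Relation.Nullary using (¬_; does)
open import Relation.Binary.PropositionalEquality using (_≡_; _≢_)

record Graph : Set where
  field
    nV   : ℕ
    nE   : ℕ
    ends : Fin nE → Fin nV × Fin nV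
open Graph public

module _ (G : Graph) where

  Incident : Fin (nE G) → Fin (nV G) → Set
  Incident e v = proj₁ (ends G e) ≡ v ⊎ proj₂ (ends G e) ≡ v

  incident? : Fin (nE G) → Fin (nV G) → Bool
  incident? e v = does (proj₁ (ends G e) ≟ v) ∨ does (proj₂ (ends G e) ≟ v)

  star : Fin (nV G) → Subset (nE G)
  star v = tabulate (λ e → if incident? e v then inside else outside)

  IsStar : Subset (nE G) → Set
  IsStar S = ∃ λ v → S ≡ star v

  IsMaxStar : Subset (nE G) → Set
  IsMaxStar S = IsStar S × ¬ (∃ λ S′ → IsStar S′ × S ⊂ S′)

  InTstar : Subset (nE G) → Set
  InTstar T = Nonempty T × ¬ IsMaxStar T

  NoIsolatedVertices : Set
  NoIsolatedVertices = ∀ v → ∃ λ e → Incident e v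

sumℚ : ∀ {n} → (Fin n → ℚ) → ℚ
sumℚ {zero}  f = 0ℚ
sumℚ {suc n} f = f zero + sumℚ (λ i → f (suc i))

weight : ∀ {m} → (Fin m → ℚ) → Subset m → ℚ
weight φ T = sumℚ (λ e → if lookup T e then φ e else 0ℚ)

StronglyEquistarable : Graph → Set
StronglyEquistarable G =
  NoIsolatedVertices G ×
  (∀ (T : Subset (nE G)) → InTstar G T →
   ∀ (γ : ℚ) → γ ≤ 1ℚ →
   ∃ λ (φ : Fin (nE G) → ℚ) →
       (∀ e → 0ℚ < φ e)
     × (∀ S → IsMaxStar G S → weight φ S ≡ 1ℚ)
     × weight φ T ≢ γ)

-- The circulant graph C_11({1,3}) on vertices 0..10.  Its 22 edges are
-- {i, i+1 mod 11} (edge index i, 0 ≤ i ≤ 10) and {i, i+3 mod 11}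
-- (edge index 11+i).  These are exactly the pairs with i-j ≡ ±1, ±3 (mod 11),
-- each listed once.
C11-1-3 : Graph
C11-1-3 = record
  { nV = 11
  ; nE = 22
  ; ends = λ e → if toℕ e <ᵇ 11
                   then (toℕ e mod 11 , (toℕ e +ℕ 1) mod 11)
                   else ((toℕ e ∸ 11) mod 11 , ((toℕ e ∸ 11) +ℕ 3) mod 11)
  }

{-# OPTIONS --safe #-}
-- The uniform weighting 1/4 is equistarable (the graph is 4-regular) and gives an edge set T the
-- weight |T|/4, which exceeds every γ ≤ 1 once |T| > 4.  For the remaining T it suffices to find
-- a second equistarable weighting on which T weighs differently, since one of the two then misses
-- γ.  Shifting 1/8 around an alternating 4-cycle preserves all star sums, and an exhaustive search
-- over the sets of at most four edges shows that, apart from ∅ and the stars (which are maximal by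
-- regularity), one of the eleven shifted weightings always changes the weight of T.
module Submission where

open import Defs
open import Data.Bool using (Bool; T; _∧_; _∨_; if_then_else_)
open import Data.Bool.Properties using (T-∧) renaming (_≟_ to _≟ᵇ_)
open import Data.Empty using (⊥-elim)
open import Data.Fin using (Fin; zero; suc; toℕ) renaming (_≟_ to _≟ᶠ_)
open import Data.Fin.Properties using (any?; all?)
open import Data.Fin.Subset using (Subset; inside; outside; ⊥; ∣_∣)
open import Data.Fin.Subset.Properties using (∉⊥; p⊂q⇒∣p∣<∣q∣)
import Data.Integer as ℤ
open import Data.Nat as ℕ using (ℕ; zero; suc; _∸_; _≡ᵇ_; _≤?_; _<?_; s≤s)
  renaming (_+_ to _+ℕ_)
open import Data.Nat.DivMod using (_%_)
import Data.Nat.Properties as ℕP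
open import Data.Product using (_,_; proj₁; proj₂; ∃; ∃₂)
open import Data.Rational using (ℚ; 0ℚ; 1ℚ; _+_; _<_; _≤_; _/_)
import Data.Rational.Properties as ℚP
open import Algebra.Properties.Monoid.Mult ℚP.+-0-monoid using (×-homo-+) renaming (_×_ to _·_)
open import Data.Sum using (_⊎_; inj₁; inj₂)
open import Data.Vec using ([]; _∷_)
open import Data.Vec.Properties using (≡-dec)
open import Function using (_∘_; Equivalence)
open import Relation.Binary.Definitions using (tri<; tri≈; tri>)
open import Relation.Binary.PropositionalEquality using (_≡_; _≢_; refl; sym; trans; cong; subst)
open import Relation.Nullary using (Dec; yes; no; ¬?; contradiction)
open import Relation.Nullary.Decidable using (⌊_⌋; from-yes; toWitness; _⊎-dec_)
open import Relation.Unary using (Pred; Decidable)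

weightℕ : ∀ {n} → (Fin n → ℕ) → Subset n → ℕ
weightℕ a []            = 0
weightℕ a (outside ∷ t) = weightℕ (a ∘ suc) t
weightℕ a (inside ∷ t)  = a zero +ℕ weightℕ (a ∘ suc) t

allWithin : ∀ {n p} {P : Pred (Subset n) p} → Decidable P → (Fin n → ℕ) → ℕ → Bool
allWithin {zero}  P? w k = ⌊ P? [] ⌋
allWithin {suc n} P? w k with w zero ≤? k
... | yes _ = allWithin (P? ∘ (outside ∷_)) (w ∘ suc) k
            ∧ allWithin (P? ∘ (inside ∷_)) (w ∘ suc) (k ∸ w zero)
... | no _  = allWithin (P? ∘ (outside ∷_)) (w ∘ suc) k

allWithin-sound : ∀ {n p} {P : Pred (Subset n) p} (P? : Decidable P) w k →
                  T (allWithin P? w k) → ∀ t → weightℕ w t ℕ.≤ k → P t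
allWithin-sound {zero}  P? w k ok [] _ = toWitness {a? = P? []} ok
allWithin-sound {suc n} P? w k ok (outside ∷ t) t≤k with w zero ≤? k
... | yes _ =
  allWithin-sound (P? ∘ (outside ∷_)) (w ∘ suc) k (proj₁ (Equivalence.to T-∧ ok)) t t≤k
... | no _  = allWithin-sound (P? ∘ (outside ∷_)) (w ∘ suc) k ok t t≤k
allWithin-sound {suc n} P? w k ok (inside ∷ t) t≤k with w zero ≤? k
... | yes _ =
  allWithin-sound (P? ∘ (inside ∷_)) (w ∘ suc) (k ∸ w zero) (proj₂ (Equivalence.to T-∧ ok)) t
    (ℕP.m+n≤o⇒m≤o∸n _ (subst (ℕ._≤ k) (ℕP.+-comm (w zero) _) t≤k))
... | no w₀≰k = contradiction (ℕP.m+n≤o⇒m≤o _ t≤k) w₀≰k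

weight-· : ∀ {n} (a : Fin n → ℕ) (x : ℚ) (t : Subset n) →
           weight (λ e → a e · x) t ≡ weightℕ a t · x
weight-· a x []            = refl
weight-· a x (outside ∷ t) =
  trans (cong (0ℚ +_) (weight-· (a ∘ suc) x t)) (ℚP.+-identityˡ _)
weight-· a x (inside ∷ t)  =
  trans (cong (a zero · x +_) (weight-· (a ∘ suc) x t)) (sym (×-homo-+ x (a zero) _))

n·x<[1+n]·x : ∀ {x} → 0ℚ < x → ∀ n → n · x < suc n · x
n·x<[1+n]·x {x} 0<x n =
  subst (_< x + n · x) (ℚP.+-identityˡ (n · x)) (ℚP.+-monoˡ-< (n · x) 0<x)

·-monoˡ-< : ∀ {x} → 0ℚ < x → ∀ {m n} → m ℕ.< n → m · x < n · x
·-monoˡ-< 0<x {m} {suc n} (s≤s m≤n) with ℕP.m≤n⇒m<n∨m≡n m≤n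
... | inj₁ m<n  = ℚP.<-trans (·-monoˡ-< 0<x m<n) (n·x<[1+n]·x 0<x n)
... | inj₂ refl = n·x<[1+n]·x 0<x m

·-cancelʳ-≡ : ∀ {x} → 0ℚ < x → ∀ {m n} → m · x ≡ n · x → m ≡ n
·-cancelʳ-≡ 0<x {m} {n} eq with ℕP.<-cmp m n
... | tri< m<n _ _ = contradiction eq (ℚP.<⇒≢ (·-monoˡ-< 0<x m<n))
... | tri≈ _ m≡n _ = m≡n
... | tri> _ _ n<m = contradiction (sym eq) (ℚP.<⇒≢ (·-monoˡ-< 0<x n<m))

SeparatedBy : ∀ {m} {I : Set} → (I → Fin m → ℚ) → Subset m → Set
SeparatedBy φ T =
  (∃ λ i → 1ℚ < weight (φ i) T) ⊎ (∃₂ λ i j → weight (φ i) T ≢ weight (φ j) T)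

separatedBy⇒avoids : ∀ {m} {I : Set} (φ : I → Fin m → ℚ) T {γ} →
                     SeparatedBy φ T → γ ≤ 1ℚ → ∃ λ i → weight (φ i) T ≢ γ
separatedBy⇒avoids φ T (inj₁ (i , 1<φᵢT)) γ≤1 =
  i , λ φᵢT≡γ → ℚP.<⇒≢ (ℚP.≤-<-trans γ≤1 1<φᵢT) (sym φᵢT≡γ)
separatedBy⇒avoids φ T {γ} (inj₂ (i , j , φᵢT≢φⱼT)) _ with weight (φ i) T ℚP.≟ γ
... | no φᵢT≢γ  = i , φᵢT≢γ
... | yes φᵢT≡γ = j , λ φⱼT≡γ → φᵢT≢φⱼT (trans φᵢT≡γ (sym φⱼT≡γ))

module _ (G : Graph) where

  noIsolatedVertices? : Dec (NoIsolatedVertices G)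
  noIsolatedVertices? =
    all? λ v → any? λ e → (proj₁ (ends G e) ≟ᶠ v) ⊎-dec (proj₂ (ends G e) ≟ᶠ v)

  isStar? : Decidable (IsStar G)
  isStar? S = any? λ v → ≡-dec _≟ᵇ_ S (star G v)

  IsRegular : ℕ → Set
  IsRegular k = ∀ v → ∣ star G v ∣ ≡ k

  regular⇒star-isMaxStar : ∀ {k} → IsRegular k → ∀ v → IsMaxStar G (star G v)
  regular⇒star-isMaxStar regular v = (v , refl) , λ { (_ , (w , refl) , v⊂w) →
    ℕP.<-irrefl (trans (regular v) (sym (regular w))) (p⊂q⇒∣p∣<∣q∣ v⊂w) }

  separation⇒stronglyEquistarable :
    NoIsolatedVertices G → {I : Set} (φ : I → Fin (nE G) → ℚ) →
    (∀ i e → 0ℚ < φ i e) → (∀ i S → IsMaxStar G S → weight (φ i) S ≡ 1ℚ) →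
    (∀ T → InTstar G T → SeparatedBy φ T) → StronglyEquistarable G
  separation⇒stronglyEquistarable noIsolated φ positive normalised separated =
    noIsolated , λ T T∈T* γ γ≤1 →
      let i , φᵢT≢γ = separatedBy⇒avoids φ T (separated T T∈T*) γ≤1
      in  φ i , positive i , normalised i , φᵢT≢γ

uniform : Fin 22 → ℕ
uniform _ = 2

-- On the alternating 4-cycle i, i+1, i+4, i+3 the edges {i,i+1}, {i+3,i+4} (indices i, i+3) gain
-- a unit and {i,i+3}, {i+1,i+4} (indices 11+i, 11+(i+1)) lose one; each vertex of the cycle meets
-- one edge of each pair, so every star keeps its weight.
alternating : Fin 11 → Fin 22 → ℕ
alternating i e =
  if (k ≡ᵇ j) ∨ (k ≡ᵇ (j +ℕ 3) % 11) then 3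
  else if (k ≡ᵇ 11 +ℕ j) ∨ (k ≡ᵇ 11 +ℕ (j +ℕ 1) % 11) then 1
  else 2
  where
  j k : ℕ
  j = toℕ i
  k = toℕ e

units : Fin 12 → Fin 22 → ℕ
units zero    = uniform
units (suc i) = alternating i

⅛ : ℚ
⅛ = ℤ.+ 1 / 8

0<⅛ : 0ℚ < ⅛
0<⅛ = from-yes (0ℚ ℚP.<? ⅛)

φ : Fin 12 → Fin 22 → ℚ
φ j e = units j e · ⅛

C11-noIsolatedVertices : NoIsolatedVertices C11-1-3
C11-noIsolatedVertices = from-yes (noIsolatedVertices? C11-1-3)

C11-regular : IsRegular C11-1-3 4
C11-regular = from-yes (all? λ v → ∣ star C11-1-3 v ∣ ℕ.≟ 4)

units-positive : ∀ j e → 0 ℕ.< units j e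
units-positive = from-yes (all? λ j → all? λ e → 0 <? units j e)

units-star : ∀ j v → weightℕ (units j) (star C11-1-3 v) ≡ 8
units-star = from-yes (all? λ j → all? λ v → weightℕ (units j) (star C11-1-3 v) ℕ.≟ 8)

Distinguishable : Subset 22 → Set
Distinguishable T =
  T ≡ ⊥ ⊎ IsStar C11-1-3 T ⊎ ∃ λ i → weightℕ (alternating i) T ≢ weightℕ uniform T

distinguishable? : Decidable Distinguishable
distinguishable? T =
  ≡-dec _≟ᵇ_ T ⊥ ⊎-dec isStar? C11-1-3 T ⊎-dec
  any? λ i → ¬? (weightℕ (alternating i) T ℕ.≟ weightℕ uniform T)

light⇒distinguishable : ∀ T → weightℕ uniform T ℕ.≤ 8 → Distinguishable T
light⇒distinguishable = allWithin-sound distinguishable? uniform 8 _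

φ-weight : ∀ j T → weight (φ j) T ≡ weightℕ (units j) T · ⅛
φ-weight j = weight-· (units j) ⅛

φ-positive : ∀ j e → 0ℚ < φ j e
φ-positive j e = ·-monoˡ-< 0<⅛ (units-positive j e)

φ-normalised : ∀ j S → IsMaxStar C11-1-3 S → weight (φ j) S ≡ 1ℚ
φ-normalised j _ ((v , refl) , _) =
  trans (φ-weight j (star C11-1-3 v)) (cong (_· ⅛) (units-star j v))

C11-separated : ∀ T → InTstar C11-1-3 T → SeparatedBy φ T
C11-separated T ((_ , x∈T) , notMax) with weightℕ uniform T ℕ.≤? 8
... | no heavy =
  inj₁ (zero , subst (1ℚ <_) (sym (φ-weight zero T)) (·-monoˡ-< 0<⅛ (ℕP.≰⇒> heavy)))
... | yes light with light⇒distinguishable T light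
...   | inj₁ refl                = ⊥-elim (∉⊥ x∈T)
...   | inj₂ (inj₁ (v , refl))   =
  ⊥-elim (notMax (regular⇒star-isMaxStar C11-1-3 C11-regular v))
...   | inj₂ (inj₂ (i , differ)) = inj₂ (suc i , zero , λ same →
  differ (·-cancelʳ-≡ 0<⅛ (trans (sym (φ-weight (suc i) T)) (trans same (φ-weight zero T)))))

proposition13 : StronglyEquistarable C11-1-3
proposition13 = separation⇒stronglyEquistarable C11-1-3
  C11-noIsolatedVertices φ φ-positive φ-normalised C11-separated
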